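{- Let $G=(V^+,V^-;E)$ be a bipartite graph with $|V^+|<|V^-|$. Then $G$ is minimally DM-irreducible if and only if both of the following hold: - $|\Gamma_G(\{u\})|=2$ for every $u\in V^+$; - $G$, viewed as an undirected graph, is a forest (it contains no cycle).
   Context: A bipartite graph $G=(V^+,V^-;E)$ has finite disjoint vertex sides $V^+,V^-$, and its edge set satisfies $E\subseteq V^+\times V^-$. For $X\subseteq V^+$, $\Gamma_G(X)$ is the set of vertices of $V^-$ adjacent to some vertex of $X$. DM-decomposition. Define $f_G(X)=|\Gamma_G(X)|-|X|$ for $X\subseteq V^+$. Its minimizers form a lattice under union and intersection. Take a maximal chain $X_0\subsetneq\cdots\subsetneq X_k$ of minimizers and set: - $V_0=X_0\cup\Gamma_G(X_0)$; - $V_i=(X_i\setminus X_{i-1})\cup(\Gamma_G(X_i)\setminus\Gamma_G(X_{i-1}))$ for $i=1,\dots,k$; - $V_\infty=(V^+\setminus X_k)\cup(V^-\setminus\Gamma_G(X_k))$. This partition of $V=V^+\cup V^-$ is independent of the chain. $G$ is DM-irreducible if exactly one part is nonempty, i.e. $V_0=V$, or $V_1=V$, or $V_\infty=V$. $G$ is minimally DM-irreducible if $G$ is DM-irreducible but $(V^+,V^-;E\setminus\{e\})$ is not DM-irreducible for every $e\in E$. -}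

module Defs where

open import Data.Bool using (Bool; true; false; _∧_; not)
open import Data.Nat using (ℕ; zero; suc)
open import Data.Integer using (ℤ; +_; _-_; _≤_)
open import Data.Fin using (Fin; zero; suc; inject₁; fromℕ; _≟_)
open import Data.Fin.Subset using (Subset; _∈_; _∉_; _⊆_; _⊂_; ∣_∣; ⁅_⁆)
open import Data.List using (allFin)
open import Data.Bool.ListAction using (any)
open import Data.Vec using (tabulate; lookup)
open import Data.Sum using (_⊎_; inj₁; inj₂)
open import Data.Product using (Σ; ∃; _×_; _,_)
open import Data.Empty using (⊥)
open import Relation.Nullary using (¬_)
open import Relation.Nullary.Decidable using (⌊_⌋)
open import Relation.Binary.PropositionalEquality using (_≡_)
open import Function.Definitions using (Injective)

-- A bipartite graph G = (V⁺, V⁻; E) with V⁺ = Fin m, V⁻ = Fin n and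
-- E ⊆ V⁺ × V⁻ given by its (decidable) indicator.
record BipGraph (m n : ℕ) : Set where
  constructor bip
  field
    edge : Fin m → Fin n → Bool

open BipGraph public

_∈E_ : ∀ {m n} → Fin m × Fin n → BipGraph m n → Set
(u , v) ∈E G = edge G u v ≡ true

Γ : ∀ {m n} → BipGraph m n → Subset m → Subset n
Γ {m} G X = tabulate (λ v → any (λ u → lookup X u ∧ edge G u v) (allFin m))

f : ∀ {m n} → BipGraph m n → Subset m → ℤ
f G X = + ∣ Γ G X ∣ - + ∣ X ∣

Minimizer : ∀ {m n} → BipGraph m n → Subset m → Set
Minimizer G X = ∀ Y → f G X ≤ f G Y

record MaximalChain {m n} (G : BipGraph m n) (k : ℕ) (X : Fin (suc k) → Subset m) : Set where
  field
    minimizers : ∀ i → Minimizer G (X i)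
    increasing : ∀ (i : Fin k) → X (inject₁ i) ⊂ X (suc i)
    maximal    : ∀ Z → Minimizer G Z → (∀ i → Z ⊆ X i ⊎ X i ⊆ Z) → ∃ λ i → X i ≡ Z

Vertex : ℕ → ℕ → Set
Vertex m n = Fin m ⊎ Fin n

-- Labels of the parts of the DM-decomposition w.r.t. a chain of length k:
-- V₀, V_i for i = 1..k (Vᵢ i represents V_{i+1}), and V_∞.
data Part (k : ℕ) : Set where
  V₀ : Part k
  Vᵢ : Fin k → Part k
  V∞ : Part k

last : ∀ k → Fin (suc k)
last k = fromℕ k

InPart : ∀ {m n k} → BipGraph m n → (Fin (suc k) → Subset m) → Part k → Vertex m n → Set
InPart G X V₀ (inj₁ u) = u ∈ X zero
InPart G X V₀ (inj₂ v) = v ∈ Γ G (X zero)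
InPart G X (Vᵢ i) (inj₁ u) = u ∈ X (suc i) × u ∉ X (inject₁ i)
InPart G X (Vᵢ i) (inj₂ v) = v ∈ Γ G (X (suc i)) × v ∉ Γ G (X (inject₁ i))
InPart {k = k} G X V∞ (inj₁ u) = u ∉ X (last k)
InPart {k = k} G X V∞ (inj₂ v) = v ∉ Γ G (X (last k))

NonemptyPart : ∀ {m n k} → BipGraph m n → (Fin (suc k) → Subset m) → Part k → Set
NonemptyPart {m} {n} G X P = Σ (Vertex m n) (InPart G X P)

-- DM-irreducible: (for a, equivalently any, maximal chain of minimizers)
-- exactly one part of the DM-decomposition is nonempty.
DMIrreducible : ∀ {m n} → BipGraph m n → Set
DMIrreducible G =
  Σ ℕ λ k → Σ (Fin (suc k) → Subset _) λ X →
    MaximalChain G k X ×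
    Σ (Part k) λ P → NonemptyPart G X P × (∀ Q → NonemptyPart G X Q → Q ≡ P)

removeEdge : ∀ {m n} → BipGraph m n → Fin m → Fin n → BipGraph m n
removeEdge G u₀ v₀ = bip (λ u v → edge G u v ∧ not (⌊ u ≟ u₀ ⌋ ∧ ⌊ v ≟ v₀ ⌋))

MinimallyDMIrreducible : ∀ {m n} → BipGraph m n → Set
MinimallyDMIrreducible G =
  DMIrreducible G × (∀ u v → (u , v) ∈E G → ¬ DMIrreducible (removeEdge G u v))

Adj : ∀ {m n} → BipGraph m n → Vertex m n → Vertex m n → Set
Adj G (inj₁ u) (inj₂ v) = (u , v) ∈E G
Adj G (inj₂ v) (inj₁ u) = (u , v) ∈E G
Adj G (inj₁ _) (inj₁ _) = ⊥
Adj G (inj₂ _) (inj₂ _) = ⊥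

Cycle : ∀ {m n} → BipGraph m n → Set
Cycle {m} {n} G =
  Σ ℕ λ l → Σ (Fin (suc (suc (suc l))) → Vertex m n) λ c →
    Injective _≡_ _≡_ c ×
    (∀ (j : Fin (suc (suc l))) → Adj G (c (inject₁ j)) (c (suc j))) ×
    Adj G (c (fromℕ (suc (suc l)))) (c zero)

IsForest : ∀ {m n} → BipGraph m n → Set
IsForest G = ¬ Cycle G

-- As |V⁺| < |V⁻|, G is DM-irreducible iff it has positive surplus, |Γ(X)| > |X| for every nonempty
-- X ⊆ V⁺: then ∅ is the only minimizer of f and the whole vertex set is V∞.
--
-- If G is minimal, deleting an edge uv destroys positive surplus, which yields a set X ∋ u with
-- |Γ(X)| ≤ |X| + 1 in which v is a private neighbour of u. For two neighbours v₁, v₂ of u, the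
-- submodularity of |Γ| makes X₁ ∩ X₂ such a set for both, and removing u from it shows deg u ≤ 2.
-- When all degrees are 2, the left vertices X of a cycle satisfy |Γ(X)| ≤ |X|, so G is a forest.
--
-- Conversely, let G be a forest with all degrees 2 and X nonempty with |Γ(X)| ≤ |X|. Removing a vertex
-- of X that has a private neighbour keeps X deficient; if there is none, every edge at X continues
-- inside X, and a non-backtracking walk runs into a cycle. Deleting any edge uv leaves
-- |Γ({u})| = 1 = |{u}|, so minimality holds as well.

module Submission where

open import Defs
open import Data.Bool using (true; false; _∧_)
import Data.Bool as Bool
open import Data.Bool.Properties using (T-≡; T-∧)
open import Data.Empty using (⊥-elim)
open import Data.Fin using (Fin; zero; suc; toℕ; fromℕ; inject₁; _≟_; join; splitAt)
open import Data.Fin.Properties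
  using (any?; all?; ¬∀⟶∃¬; suc-injective; 0≢1+n; toℕ-injective; toℕ-inject₁; toℕ-fromℕ; toℕ<n)
open import Data.Fin.Properties using (splitAt-join; pigeonhole)
open import Data.Fin.Subset
open import Data.Fin.Subset.Properties
import Data.Integer as ℤ
open import Data.Integer using (0ℤ; +≤+)
import Data.Integer.Properties as ℤₚ
open import Data.Integer.Properties using (drop‿+≤+; i≤j⇒0≤j-i; i≤j⇒i-j≤0; i-j≤0⇒i≤j)
open import Data.List using (allFin)
open import Data.List.Membership.Propositional using (lose)
open import Data.List.Membership.Propositional.Properties using (∈-allFin)
open import Data.List.Relation.Unary.Any using (satisfied)
open import Data.List.Relation.Unary.Any.Properties using (any⁺; any⁻)
open import Data.Nat using (ℕ; zero; suc; _+_; _≤_; _<_; _≤?_; z≤n; s≤s; s≤s⁻¹; z<s)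
open import Data.Nat.Induction using (<-rec)
open import Data.Nat.Properties hiding (_≟_; suc-injective; 0≢1+n)
open import Data.Product using (Σ; ∃; ∃₂; _×_; _,_; proj₁; proj₂)
open import Data.Sum using (_⊎_; inj₁; inj₂)
open import Data.Sum.Properties using (inj₁-injective; inj₂-injective; ≡-dec)
open import Data.Vec using ([]; _∷_; here; there; tabulate)
open import Data.Vec.Properties using ([]=⇒lookup; lookup⇒[]=; lookup∘tabulate)
open import Function using (_∘_; _⇔_; mk⇔; Equivalence)
open import Relation.Binary.PropositionalEquality
open import Relation.Nullary using (¬_; yes; no; Dec; ¬?; does)
open import Relation.Nullary.Decidable using (_×-dec_; decidable-stable; dec-true)
open import Relation.Unary using (Decidable)
open import Relation.Binary.Definitions using (tri<; tri≈; tri>)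

open Equivalence using (to; from)

-- Finite subsets

∣p∪q∣+∣p∩q∣≡∣p∣+∣q∣ : ∀ {n} (p q : Subset n) → ∣ p ∪ q ∣ + ∣ p ∩ q ∣ ≡ ∣ p ∣ + ∣ q ∣
∣p∪q∣+∣p∩q∣≡∣p∣+∣q∣ []          []          = refl
∣p∪q∣+∣p∩q∣≡∣p∣+∣q∣ (true ∷ p)  (true ∷ q)  =
  cong suc (trans (+-suc _ _) (trans (cong suc (∣p∪q∣+∣p∩q∣≡∣p∣+∣q∣ p q)) (sym (+-suc _ _))))
∣p∪q∣+∣p∩q∣≡∣p∣+∣q∣ (true ∷ p)  (false ∷ q) = cong suc (∣p∪q∣+∣p∩q∣≡∣p∣+∣q∣ p q)
∣p∪q∣+∣p∩q∣≡∣p∣+∣q∣ (false ∷ p) (true ∷ q)  = trans (cong suc (∣p∪q∣+∣p∩q∣≡∣p∣+∣q∣ p q)) (sym (+-suc _ _))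
∣p∪q∣+∣p∩q∣≡∣p∣+∣q∣ (false ∷ p) (false ∷ q) = ∣p∪q∣+∣p∩q∣≡∣p∣+∣q∣ p q

∣p∪q∣≤∣p∣+∣q∣ : ∀ {n} (p q : Subset n) → ∣ p ∪ q ∣ ≤ ∣ p ∣ + ∣ q ∣
∣p∪q∣≤∣p∣+∣q∣ p q = subst (∣ p ∪ q ∣ ≤_) (∣p∪q∣+∣p∩q∣≡∣p∣+∣q∣ p q) (m≤m+n _ _)

x∈p─q⇒x∉q : ∀ {n} {p q : Subset n} {x} → x ∈ p ─ q → x ∉ q
x∈p─q⇒x∉q {p = true ∷ p}  {false ∷ q} here      ()
x∈p─q⇒x∉q {p = _ ∷ p}     {false ∷ q} (there h) (there h′) = x∈p─q⇒x∉q h h′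
x∈p─q⇒x∉q {p = _ ∷ p}     {true ∷ q}  (there h) (there h′) = x∈p─q⇒x∉q h h′

x∈p-y⇒x≢y : ∀ {n} {p : Subset n} {x y} → x ∈ p - y → x ≢ y
x∈p-y⇒x≢y x∈p-y refl = x∈p─q⇒x∉q x∈p-y (x∈⁅x⁆ _)

∣p∣≤1+∣p-x∣ : ∀ {n} (p : Subset n) x → ∣ p ∣ ≤ suc ∣ p - x ∣
∣p∣≤1+∣p-x∣ p x = begin
  ∣ p ∣                 ≤⟨ p⊆q⇒∣p∣≤∣q∣ p⊆[p-x]∪⁅x⁆ ⟩
  ∣ (p - x) ∪ ⁅ x ⁆ ∣   ≤⟨ ∣p∪q∣≤∣p∣+∣q∣ (p - x) ⁅ x ⁆ ⟩
  ∣ p - x ∣ + ∣ ⁅ x ⁆ ∣ ≡⟨ cong (∣ p - x ∣ +_) (∣⁅x⁆∣≡1 x) ⟩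
  ∣ p - x ∣ + 1         ≡⟨ +-comm _ 1 ⟩
  suc ∣ p - x ∣         ∎
  where
  open ≤-Reasoning
  p⊆[p-x]∪⁅x⁆ : p ⊆ (p - x) ∪ ⁅ x ⁆
  p⊆[p-x]∪⁅x⁆ {y} y∈p with y ≟ x
  ... | yes refl = x∈p∪q⁺ (inj₂ (x∈⁅x⁆ x))
  ... | no  y≢x  = x∈p∪q⁺ (inj₁ (x∈p∧x≢y⇒x∈p-y y∈p y≢x))

Empty⇒∣p∣≡0 : ∀ {n} {p : Subset n} → Empty p → ∣ p ∣ ≡ 0
Empty⇒∣p∣≡0 {n} empty = trans (cong ∣_∣ (Empty-unique empty)) (∣⊥∣≡0 n)

0<∣p∣⇒Nonempty : ∀ {n} {p : Subset n} → 0 < ∣ p ∣ → Nonempty p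
0<∣p∣⇒Nonempty {p = p} 0<∣p∣ with nonempty? p
... | yes nonempty = nonempty
... | no  empty    = ⊥-elim (<-irrefl (sym (Empty⇒∣p∣≡0 empty)) 0<∣p∣)

2≤∣p∣⇒∃≢ : ∀ {n} {p : Subset n} → 2 ≤ ∣ p ∣ → ∀ y → ∃ λ x → x ∈ p × x ≢ y
2≤∣p∣⇒∃≢ {p = p} 2≤∣p∣ y with 0<∣p∣⇒Nonempty (s≤s⁻¹ (≤-trans 2≤∣p∣ (∣p∣≤1+∣p-x∣ p y)))
... | x , x∈p-y = x , p─q⊆p p ⁅ y ⁆ x∈p-y , x∈p-y⇒x≢y x∈p-y

∣p∣≤2⇒x≡a⊎x≡b : ∀ {n} {p : Subset n} {a b x} →
                ∣ p ∣ ≤ 2 → a ∈ p → b ∈ p → a ≢ b → x ∈ p → x ≡ a ⊎ x ≡ b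
∣p∣≤2⇒x≡a⊎x≡b {p = p} {a} {b} {x} ∣p∣≤2 a∈p b∈p a≢b x∈p with x ≟ a | x ≟ b
... | yes x≡a | _       = inj₁ x≡a
... | no  _   | yes x≡b = inj₂ x≡b
... | no  x≢a | no  x≢b = ⊥-elim (<⇒≱ 2<∣p∣ ∣p∣≤2)
  where
  b∈p-a : b ∈ p - a
  b∈p-a = x∈p∧x≢y⇒x∈p-y b∈p (a≢b ∘ sym)
  x∈p-a-b : x ∈ p - a - b
  x∈p-a-b = x∈p∧x≢y⇒x∈p-y (x∈p∧x≢y⇒x∈p-y x∈p x≢a) x≢b
  2<∣p∣ : 2 < ∣ p ∣
  2<∣p∣ = ≤-trans (s≤s (≤-trans (s≤s (≤-trans (s≤s z≤n) (x∈p⇒∣p-x∣<∣p∣ x∈p-a-b)))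
                                (x∈p⇒∣p-x∣<∣p∣ b∈p-a)))
                  (x∈p⇒∣p-x∣<∣p∣ a∈p)

x∈p⇒⁅x⁆⊆p : ∀ {n} {p : Subset n} {x} → x ∈ p → ⁅ x ⁆ ⊆ p
x∈p⇒⁅x⁆⊆p {p = p} {x} x∈p y∈⁅x⁆ = subst (_∈ p) (sym (x∈⁅y⁆⇒x≡y x y∈⁅x⁆)) x∈p

Empty[p-x]⇒p≡⁅x⁆ : ∀ {n} {p : Subset n} {x} → x ∈ p → Empty (p - x) → p ≡ ⁅ x ⁆
Empty[p-x]⇒p≡⁅x⁆ {x = x} x∈p empty = ⊆-antisym p⊆⁅x⁆ (x∈p⇒⁅x⁆⊆p x∈p)
  where
  p⊆⁅x⁆ : _ ⊆ ⁅ x ⁆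
  p⊆⁅x⁆ {y} y∈p with y ≟ x
  ... | yes refl = x∈⁅x⁆ x
  ... | no  y≢x  = ⊥-elim (empty (y , x∈p∧x≢y⇒x∈p-y y∈p y≢x))

∣p∣<∣q∣⇒∃∈∉ : ∀ {n} {p q : Subset n} → ∣ p ∣ < ∣ q ∣ → ∃ λ x → x ∈ q × x ∉ p
∣p∣<∣q∣⇒∃∈∉ {p = p} {q} ∣p∣<∣q∣ with any? (λ x → x ∈? q ×-dec ¬? (x ∈? p))
... | yes witness = witness
... | no  none    = ⊥-elim (<⇒≱ ∣p∣<∣q∣ (p⊆q⇒∣p∣≤∣q∣ q⊆p))
  where
  q⊆p : q ⊆ p
  q⊆p {x} x∈q = decidable-stable (x ∈? p) (λ x∉p → none (x , x∈q , x∉p))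

injection⇒∣p∣≤∣q∣ : ∀ {n n′} (p : Subset n) {q : Subset n′} (R : Fin n → Fin n′ → Set) →
                    (∀ {x} → x ∈ p → ∃ λ y → y ∈ q × R x y) →
                    (∀ {x x′ y} → R x y → R x′ y → x ≡ x′) →
                    ∣ p ∣ ≤ ∣ q ∣
injection⇒∣p∣≤∣q∣ []          R image injective = z≤n
injection⇒∣p∣≤∣q∣ (false ∷ p) R image injective =
  injection⇒∣p∣≤∣q∣ p (R ∘ suc) (λ x∈p → image (there x∈p)) (λ r r′ → suc-injective (injective r r′))
injection⇒∣p∣≤∣q∣ (true ∷ p) {q} R image injective with y₀ , y₀∈q , R0y₀ ← image here =
  ≤-trans (s≤s (injection⇒∣p∣≤∣q∣ p {q - y₀} (R ∘ suc) image′ (λ r r′ → suc-injective (injective r r′))))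
          (x∈p⇒∣p-x∣<∣p∣ y₀∈q)
  where
  image′ : ∀ {x} → x ∈ p → ∃ λ y → y ∈ q - y₀ × R (suc x) y
  image′ x∈p with y , y∈q , r ← image (there x∈p) =
    y , x∈p∧x≢y⇒x∈p-y y∈q (λ { refl → 0≢1+n (injective R0y₀ r) }) , r

subset : ∀ {n} {P : Fin n → Set} → Decidable P → Subset n
subset P? = tabulate (does ∘ P?)

∈subset⁺ : ∀ {n} {P : Fin n → Set} (P? : Decidable P) {x} → P x → x ∈ subset P?
∈subset⁺ P? {x} px = lookup⇒[]= x _ (trans (lookup∘tabulate _ x) (dec-true (P? x) px))

∈subset⁻ : ∀ {n} {P : Fin n → Set} (P? : Decidable P) {x} → x ∈ subset P? → P x
∈subset⁻ P? {x} x∈P with P? x | trans (sym (lookup∘tabulate (does ∘ P?) x)) ([]=⇒lookup x∈P)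
... | yes px | _  = px
... | no  _  | ()

-- Repetitions and cyclic positions

Least : (ℕ → Set) → ℕ → Set
Least P i = P i × (∀ {k} → k < i → ¬ P k)

least : ∀ {P : ℕ → Set} → Decidable P → ∀ j → P j → ∃ (Least P)
least {P} P? = <-rec (λ j → P j → ∃ (Least P)) search
  where
  search : ∀ j → (∀ {k} → k < j → P k → ∃ (Least P)) → P j → ∃ (Least P)
  search j smaller pj with anyUpTo? P? j
  ... | yes (k , k<j , pk) = smaller k<j pk
  ... | no  none           = j , pj , λ k<j pk → none (_ , k<j , pk)

Repeat : ∀ {A : Set} → (ℕ → A) → ℕ → Set
Repeat w j = ∃ λ i → i < j × w i ≡ w j

walk-repeats : ∀ {m n} (w : ℕ → Vertex m n) → ∃ (Repeat w)
walk-repeats {m} {n} w with i , j , i<j , eq ← pigeonhole (n<1+n (m + n)) (join m n ∘ w ∘ toℕ) =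
  toℕ j , toℕ i , i<j , trans (sym (splitAt-join m n _)) (trans (cong (splitAt m) eq) (splitAt-join m n _))

prev : ∀ {N} → Fin (suc N) → Fin (suc N)
prev zero    = fromℕ _
prev (suc i) = inject₁ i

next : ∀ {N} → Fin (suc N) → Fin (suc N)
next {zero}  zero    = zero
next {suc N} zero    = suc zero
next {suc N} (suc i) with next i
... | zero  = zero
... | suc j = suc (suc j)

prev-next : ∀ {N} (i : Fin (suc N)) → prev (next i) ≡ i
prev-next {zero}  zero    = refl
prev-next {suc N} zero    = refl
prev-next {suc N} (suc i) with next i | prev-next i
... | zero  | eq = cong suc eq
... | suc _ | eq = cong suc eq

next-injective : ∀ {N} {i j : Fin (suc N)} → next i ≡ next j → i ≡ j
next-injective {i = i} {j} eq = trans (sym (prev-next i)) (trans (cong prev eq) (prev-next j))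

prev-prev≢id : ∀ {l} (i : Fin (3 + l)) → prev (prev i) ≢ i
prev-prev≢id zero          ()
prev-prev≢id (suc zero)    ()
prev-prev≢id (suc (suc j)) eq = m≢1+n+m (toℕ j) {1}
  (trans (sym (trans (toℕ-inject₁ (inject₁ j)) (toℕ-inject₁ j))) (cong toℕ eq))

prev≢next : ∀ {l} (i : Fin (3 + l)) → prev i ≢ next i
prev≢next i eq = prev-prev≢id i (trans (cong prev eq) (prev-next i))

-- Neighbourhoods

module _ {m n : ℕ} (G : BipGraph m n) where

  ∈Γ⁺ : ∀ {X u v} → u ∈ X → (u , v) ∈E G → v ∈ Γ G X
  ∈Γ⁺ {X} {u} {v} u∈X uv∈E =
    lookup⇒[]= v (Γ G X) (trans (lookup∘tabulate _ v) (to T-≡ (any⁺ _ (lose (∈-allFin u)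
      (from T-≡ (cong₂ _∧_ ([]=⇒lookup u∈X) uv∈E))))))

  ∈Γ⁻ : ∀ {X v} → v ∈ Γ G X → ∃ λ u → u ∈ X × (u , v) ∈E G
  ∈Γ⁻ {X} {v} v∈ΓX
    with u , t ← satisfied (any⁻ _ (allFin m)
                   (from T-≡ (trans (sym (lookup∘tabulate _ v)) ([]=⇒lookup v∈ΓX))))
    with t∈X , t∈E ← to T-∧ t
    = u , lookup⇒[]= u X (to T-≡ t∈X) , to T-≡ t∈E

  ∈Γ⁅⁆⁻ : ∀ {u v} → v ∈ Γ G ⁅ u ⁆ → (u , v) ∈E G
  ∈Γ⁅⁆⁻ {u} v∈Γu with x , x∈⁅u⁆ , xv∈E ← ∈Γ⁻ v∈Γu =
    subst (λ x → (x , _) ∈E G) (x∈⁅y⁆⇒x≡y u x∈⁅u⁆) xv∈E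

  Γ-mono : ∀ {X Y} → X ⊆ Y → Γ G X ⊆ Γ G Y
  Γ-mono X⊆Y v∈ΓX with u , u∈X , uv∈E ← ∈Γ⁻ v∈ΓX = ∈Γ⁺ (X⊆Y u∈X) uv∈E

  Γ-∪ : ∀ X Y → Γ G (X ∪ Y) ⊆ Γ G X ∪ Γ G Y
  Γ-∪ X Y v∈Γ[X∪Y] with u , u∈X∪Y , uv∈E ← ∈Γ⁻ v∈Γ[X∪Y] with x∈p∪q⁻ X Y u∈X∪Y
  ... | inj₁ u∈X = x∈p∪q⁺ (inj₁ (∈Γ⁺ u∈X uv∈E))
  ... | inj₂ u∈Y = x∈p∪q⁺ (inj₂ (∈Γ⁺ u∈Y uv∈E))

  Γ-∩ : ∀ X Y → Γ G (X ∩ Y) ⊆ Γ G X ∩ Γ G Y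
  Γ-∩ X Y v∈Γ[X∩Y] = x∈p∩q⁺ (Γ-mono (p∩q⊆p X Y) v∈Γ[X∩Y] , Γ-mono (p∩q⊆q X Y) v∈Γ[X∩Y])

  Γ-submodular : ∀ X Y → ∣ Γ G (X ∪ Y) ∣ + ∣ Γ G (X ∩ Y) ∣ ≤ ∣ Γ G X ∣ + ∣ Γ G Y ∣
  Γ-submodular X Y = ≤-trans (+-mono-≤ (p⊆q⇒∣p∣≤∣q∣ (Γ-∪ X Y)) (p⊆q⇒∣p∣≤∣q∣ (Γ-∩ X Y)))
                             (≤-reflexive (∣p∪q∣+∣p∩q∣≡∣p∣+∣q∣ (Γ G X) (Γ G Y)))

  Γ-⊥ : Γ G ⊥ ≡ ⊥
  Γ-⊥ = Empty-unique λ (v , v∈Γ⊥) → ∉⊥ (proj₁ (proj₂ (∈Γ⁻ v∈Γ⊥)))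

  Adj-sym : ∀ {a b} → Adj G a b → Adj G b a
  Adj-sym {inj₁ _} {inj₂ _} ab = ab
  Adj-sym {inj₂ _} {inj₁ _} ab = ab

  Adj-respˡ : ∀ {a a′ b} → a ≡ a′ → Adj G a b → Adj G a′ b
  Adj-respˡ refl ab = ab

  Adj-irrefl : ∀ {a} → ¬ Adj G a a
  Adj-irrefl {inj₁ _} ()
  Adj-irrefl {inj₂ _} ()

  Adj-inj₁ : ∀ {u b} → Adj G (inj₁ u) b → ∃ λ v → b ≡ inj₂ v × (u , v) ∈E G
  Adj-inj₁ {b = inj₂ v} uv∈E = v , refl , uv∈E

  Adj-inj₂ : ∀ {v b} → Adj G (inj₂ v) b → ∃ λ u → b ≡ inj₁ u × (u , v) ∈E G
  Adj-inj₂ {b = inj₁ u} uv∈E = u , refl , uv∈E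

PrivateNeighbour : ∀ {m n} → BipGraph m n → Subset m → Fin m → Fin n → Set
PrivateNeighbour G X u v = (u , v) ∈E G × (∀ x → x ∈ X → (x , v) ∈E G → x ≡ u)

Γ-remove-private : ∀ {m n} (G : BipGraph m n) {X u v} → PrivateNeighbour G X u v → Γ G (X - u) ⊆ Γ G X - v
Γ-remove-private G {X} {u} (_ , only-u) {w} w∈Γ[X-u] with x , x∈X-u , xw∈E ← ∈Γ⁻ G w∈Γ[X-u] =
  x∈p∧x≢y⇒x∈p-y (∈Γ⁺ G x∈X xw∈E) (λ { refl → x∈p-y⇒x≢y x∈X-u (only-u x x∈X xw∈E) })
  where
  x∈X : x ∈ X
  x∈X = p─q⊆p X ⁅ u ⁆ x∈X-u

module _ {m n : ℕ} (G : BipGraph m n) (u₀ : Fin m) (v₀ : Fin n) where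

  private
    G₀ : BipGraph m n
    G₀ = removeEdge G u₀ v₀

  ∈E-removeEdge⁺ : ∀ {u v} → (u , v) ∈E G → ¬ (u ≡ u₀ × v ≡ v₀) → (u , v) ∈E G₀
  ∈E-removeEdge⁺ {u} {v} uv∈E uv≢u₀v₀ with edge G u v | u ≟ u₀ | v ≟ v₀
  ... | true | yes u≡u₀ | yes v≡v₀ = ⊥-elim (uv≢u₀v₀ (u≡u₀ , v≡v₀))
  ... | true | yes _    | no  _    = refl
  ... | true | no  _    | _        = refl

  ∈E-removeEdge⁻ : ∀ {u v} → (u , v) ∈E G₀ → (u , v) ∈E G × ¬ (u ≡ u₀ × v ≡ v₀)
  ∈E-removeEdge⁻ {u} {v} uv∈E₀ with edge G u v | u ≟ u₀ | v ≟ v₀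
  ... | true | yes _    | no  v≢v₀ = refl , v≢v₀ ∘ proj₂
  ... | true | no  u≢u₀ | _        = refl , u≢u₀ ∘ proj₁

  Γ-removeEdge : ∀ {X} → Γ G X - v₀ ⊆ Γ G₀ X
  Γ-removeEdge {X} {v} v∈ΓX-v₀ with u , u∈X , uv∈E ← ∈Γ⁻ G (p─q⊆p (Γ G X) ⁅ v₀ ⁆ v∈ΓX-v₀) =
    ∈Γ⁺ G₀ {X} u∈X (∈E-removeEdge⁺ uv∈E (x∈p-y⇒x≢y v∈ΓX-v₀ ∘ proj₂))

  ∣Γ∣≤1+∣Γ-removeEdge∣ : ∀ X → ∣ Γ G X ∣ ≤ suc ∣ Γ G₀ X ∣
  ∣Γ∣≤1+∣Γ-removeEdge∣ X = ≤-trans (∣p∣≤1+∣p-x∣ (Γ G X) v₀) (s≤s (p⊆q⇒∣p∣≤∣q∣ (Γ-removeEdge {X})))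

  v₀∉Γ-removeEdge⇒only-u₀ : ∀ {X} → v₀ ∉ Γ G₀ X → ∀ x → x ∈ X → (x , v₀) ∈E G → x ≡ u₀
  v₀∉Γ-removeEdge⇒only-u₀ v₀∉Γ₀X x x∈X xv₀∈E = decidable-stable (x ≟ u₀) λ x≢u₀ →
    v₀∉Γ₀X (∈Γ⁺ G₀ x∈X (∈E-removeEdge⁺ xv₀∈E (x≢u₀ ∘ proj₁)))

  v₀∉Γ-removeEdge⇒private : ∀ {X} → v₀ ∈ Γ G X → v₀ ∉ Γ G₀ X → u₀ ∈ X × PrivateNeighbour G X u₀ v₀
  v₀∉Γ-removeEdge⇒private {X} v₀∈ΓX v₀∉Γ₀X
    with x , x∈X , xv₀∈E ← ∈Γ⁻ G v₀∈ΓX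
    with refl ← v₀∉Γ-removeEdge⇒only-u₀ v₀∉Γ₀X x x∈X xv₀∈E
    = x∈X , xv₀∈E , v₀∉Γ-removeEdge⇒only-u₀ v₀∉Γ₀X

  Γ⁅u₀⁆-removeEdge : Γ G₀ ⁅ u₀ ⁆ ⊆ Γ G ⁅ u₀ ⁆ - v₀
  Γ⁅u₀⁆-removeEdge {v} v∈Γ₀u₀ with uv∈E , uv≢u₀v₀ ← ∈E-removeEdge⁻ (∈Γ⁅⁆⁻ G₀ v∈Γ₀u₀) =
    x∈p∧x≢y⇒x∈p-y (∈Γ⁺ G (x∈⁅x⁆ u₀) uv∈E) (λ v≡v₀ → uv≢u₀v₀ (refl , v≡v₀))

-- Positive surplus and the DM-decomposition

PositiveSurplus : ∀ {m n} → BipGraph m n → Set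
PositiveSurplus {m} G = ∀ (X : Subset m) → Nonempty X → ∣ X ∣ < ∣ Γ G X ∣

Tight : ∀ {m n} → BipGraph m n → Subset m → Set
Tight G X = ∣ Γ G X ∣ ≤ suc ∣ X ∣

module _ {m n : ℕ} (G : BipGraph m n) where

  positiveSurplus⇒∣X∣≤∣ΓX∣ : PositiveSurplus G → ∀ X → ∣ X ∣ ≤ ∣ Γ G X ∣
  positiveSurplus⇒∣X∣≤∣ΓX∣ surplus X with nonempty? X
  ... | yes nonempty = <⇒≤ (surplus X nonempty)
  ... | no  empty    = subst (_≤ ∣ Γ G X ∣) (sym (Empty⇒∣p∣≡0 empty)) z≤n

  positiveSurplus⇒2≤degree : PositiveSurplus G → ∀ u → 2 ≤ ∣ Γ G ⁅ u ⁆ ∣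
  positiveSurplus⇒2≤degree surplus u = subst (_< ∣ Γ G ⁅ u ⁆ ∣) (∣⁅x⁆∣≡1 u) (surplus ⁅ u ⁆ (u , x∈⁅x⁆ u))

  ¬positiveSurplus⇒deficient : ¬ PositiveSurplus G → ∃ λ X → Nonempty X × ∣ Γ G X ∣ ≤ ∣ X ∣
  ¬positiveSurplus⇒deficient ¬surplus with anySubset? (λ X → nonempty? X ×-dec ∣ Γ G X ∣ ≤? ∣ X ∣)
  ... | yes deficient = deficient
  ... | no  none      = ⊥-elim (¬surplus λ X nonempty → ≰⇒> (λ ∣ΓX∣≤∣X∣ → none (X , nonempty , ∣ΓX∣≤∣X∣)))

  tight-∩ : ∀ {X Y} → PositiveSurplus G → Nonempty X → Tight G X → Tight G Y → Tight G (X ∩ Y)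
  tight-∩ {X} {Y} surplus (u , u∈X) tight-X tight-Y = +-cancelˡ-≤ (suc ∣ X ∪ Y ∣) _ _ (begin
    suc ∣ X ∪ Y ∣ + ∣ Γ G (X ∩ Y) ∣         ≤⟨ +-monoˡ-≤ _ (surplus (X ∪ Y) (u , x∈p∪q⁺ (inj₁ u∈X))) ⟩
    ∣ Γ G (X ∪ Y) ∣ + ∣ Γ G (X ∩ Y) ∣       ≤⟨ Γ-submodular G X Y ⟩
    ∣ Γ G X ∣ + ∣ Γ G Y ∣                   ≤⟨ +-mono-≤ tight-X tight-Y ⟩
    suc ∣ X ∣ + suc ∣ Y ∣                   ≡⟨ cong suc (+-suc ∣ X ∣ ∣ Y ∣) ⟩
    suc (suc (∣ X ∣ + ∣ Y ∣))               ≡⟨ cong (2 +_) (∣p∪q∣+∣p∩q∣≡∣p∣+∣q∣ X Y) ⟨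
    suc (suc (∣ X ∪ Y ∣ + ∣ X ∩ Y ∣))       ≡⟨ cong suc (+-suc ∣ X ∪ Y ∣ ∣ X ∩ Y ∣) ⟨
    suc ∣ X ∪ Y ∣ + suc ∣ X ∩ Y ∣           ∎)
    where open ≤-Reasoning

module _ {m n : ℕ} (G : BipGraph m n) where

  f-⊥ : f G ⊥ ≡ 0ℤ
  f-⊥ = cong₂ (λ a b → ℤ.+ a ℤ.- ℤ.+ b) (trans (cong ∣_∣ (Γ-⊥ G)) (∣⊥∣≡0 n)) (∣⊥∣≡0 m)

  deficient⇒f≤0 : ∀ {X} → ∣ Γ G X ∣ ≤ ∣ X ∣ → f G X ℤ.≤ 0ℤ
  deficient⇒f≤0 ∣ΓX∣≤∣X∣ = i≤j⇒i-j≤0 (+≤+ ∣ΓX∣≤∣X∣)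

  minimizer⇒deficient : ∀ {X} → Minimizer G X → ∣ Γ G X ∣ ≤ ∣ X ∣
  minimizer⇒deficient {X} minimizer = drop‿+≤+ (i-j≤0⇒i≤j (subst (f G X ℤ.≤_) f-⊥ (minimizer ⊥)))

  deficient⇒minimizer : ∀ {Y} → Minimizer G ⊥ → ∣ Γ G Y ∣ ≤ ∣ Y ∣ → Minimizer G Y
  deficient⇒minimizer {Y} ⊥-min ∣ΓY∣≤∣Y∣ Z =
    ℤₚ.≤-trans (deficient⇒f≤0 {Y} ∣ΓY∣≤∣Y∣) (subst (ℤ._≤ f G Z) f-⊥ (⊥-min Z))

  ⊥-minimizer : PositiveSurplus G → Minimizer G ⊥
  ⊥-minimizer surplus Y =
    subst (ℤ._≤ f G Y) (sym f-⊥) (i≤j⇒0≤j-i (+≤+ (positiveSurplus⇒∣X∣≤∣ΓX∣ G surplus Y)))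

  V∞-nonempty : ∀ {k X} → m < n → MaximalChain G k X → NonemptyPart G X V∞
  V∞-nonempty {k} {X} m<n chain with all? (λ v → v ∈? Γ G (X (last k)))
  ... | no  ¬all = let v , v∉ΓXₖ = ¬∀⟶∃¬ n _ (λ v → v ∈? Γ G (X (last k))) ¬all in inj₂ v , v∉ΓXₖ
  ... | yes all  =
    ⊥-elim (<⇒≱ ∣Xₖ∣<∣ΓXₖ∣ (minimizer⇒deficient {X (last k)} (MaximalChain.minimizers chain (last k))))
    where
    open ≤-Reasoning
    ∣Xₖ∣<∣ΓXₖ∣ : ∣ X (last k) ∣ < ∣ Γ G (X (last k)) ∣
    ∣Xₖ∣<∣ΓXₖ∣ = begin-strict
      ∣ X (last k) ∣       ≤⟨ ∣p∣≤n (X (last k)) ⟩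
      m                    <⟨ m<n ⟩
      n                    ≡⟨ ∣⊤∣≡n n ⟨
      ∣ ⊤ {n} ∣            ≤⟨ p⊆q⇒∣p∣≤∣q∣ {p = ⊤} (λ {v} _ → all v) ⟩
      ∣ Γ G (X (last k)) ∣ ∎

  positiveSurplus⇒dmIrreducible : m < n → PositiveSurplus G → DMIrreducible G
  positiveSurplus⇒dmIrreducible m<n surplus =
    0 , (λ _ → ⊥) , chain , V∞ , V∞-nonempty m<n chain , only-V∞
    where
    chain : MaximalChain G 0 (λ _ → ⊥)
    chain = record
      { minimizers = λ _ → ⊥-minimizer surplus
      ; increasing = λ ()
      ; maximal    = λ Z minimizer _ → zero , sym (Empty-unique λ nonempty →
                       <⇒≱ (surplus Z nonempty) (minimizer⇒deficient {Z} minimizer))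
      }
    only-V∞ : ∀ Q → NonemptyPart G (λ _ → ⊥) Q → Q ≡ V∞
    only-V∞ V₀ (inj₁ u , u∈⊥)  = ⊥-elim (∉⊥ u∈⊥)
    only-V∞ V₀ (inj₂ v , v∈Γ⊥) = ⊥-elim (∉⊥ (subst (v ∈_) (Γ-⊥ G) v∈Γ⊥))
    only-V∞ (Vᵢ ())
    only-V∞ V∞ _ = refl

  only-V∞⇒positiveSurplus : ∀ {k X} → MaximalChain G k X →
                            (∀ Q → NonemptyPart G X Q → Q ≡ V∞) → PositiveSurplus G
  only-V∞⇒positiveSurplus {suc k} chain only-V∞
    with _ , u , u∈X₁ , u∉X₀ ← MaximalChain.increasing chain zero
    with only-V∞ (Vᵢ zero) (inj₁ u , u∈X₁ , u∉X₀)
  ... | ()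
  only-V∞⇒positiveSurplus {zero} {X} chain only-V∞ Y nonempty =
    ≰⇒> λ ∣ΓY∣≤∣Y∣ → X₀-empty (subst Nonempty (sym (X₀≡Y ∣ΓY∣≤∣Y∣)) nonempty)
    where
    open MaximalChain chain
    X₀-empty : Empty (X zero)
    X₀-empty (u , u∈X₀) with only-V∞ V₀ (inj₁ u , u∈X₀)
    ... | ()
    ⊥-minimizer₀ : Minimizer G ⊥
    ⊥-minimizer₀ = subst (Minimizer G) (Empty-unique X₀-empty) (minimizers zero)
    X₀≡Y : ∣ Γ G Y ∣ ≤ ∣ Y ∣ → X zero ≡ Y
    X₀≡Y ∣ΓY∣≤∣Y∣
      with zero , X₀≡Y ← maximal Y (deficient⇒minimizer {Y} ⊥-minimizer₀ ∣ΓY∣≤∣Y∣)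
                                  (λ { zero → inj₂ (⊥-elim ∘ X₀-empty ∘ (_ ,_)) })
      = X₀≡Y

  dmIrreducible⇔positiveSurplus : m < n → DMIrreducible G ⇔ PositiveSurplus G
  dmIrreducible⇔positiveSurplus m<n = mk⇔
    (λ (_ , _ , chain , _ , _ , only-P) → only-V∞⇒positiveSurplus chain λ Q nonempty →
      trans (only-P Q nonempty) (sym (only-P V∞ (V∞-nonempty m<n chain))))
    (positiveSurplus⇒dmIrreducible m<n)

-- Minimal DM-irreducibility forces degree two and acyclicity

module _ {m n : ℕ} (G : BipGraph m n) where

  PrivateNeighbour-restrict : ∀ {X Y u v} → Y ⊆ X → PrivateNeighbour G X u v → PrivateNeighbour G Y u v
  PrivateNeighbour-restrict Y⊆X (uv∈E , only-u) = uv∈E , λ x x∈Y → only-u x (Y⊆X x∈Y)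

  critical-edge⇒tight-set : ∀ {u v} → PositiveSurplus G → ¬ PositiveSurplus (removeEdge G u v) →
                            ∃ λ X → u ∈ X × PrivateNeighbour G X u v × Tight G X
  critical-edge⇒tight-set {u} {v} surplus ¬surplus₀
    with X , nonempty , ∣Γ₀X∣≤∣X∣ ← ¬positiveSurplus⇒deficient (removeEdge G u v) ¬surplus₀
    with w , w∈ΓX , w∉Γ₀X ← ∣p∣<∣q∣⇒∃∈∉ (≤-<-trans ∣Γ₀X∣≤∣X∣ (surplus X nonempty))
    with w ≟ v
  ... | no  w≢v  = ⊥-elim (w∉Γ₀X (Γ-removeEdge G u v {X} (x∈p∧x≢y⇒x∈p-y w∈ΓX w≢v)))
  ... | yes refl with u∈X , v-private ← v₀∉Γ-removeEdge⇒private G u v w∈ΓX w∉Γ₀X =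
    X , u∈X , v-private , ≤-trans (∣Γ∣≤1+∣Γ-removeEdge∣ G u v X) (s≤s ∣Γ₀X∣≤∣X∣)

  two-private-neighbours⇒degree≤2 : ∀ {Y u v₁ v₂} → PositiveSurplus G → u ∈ Y → Tight G Y →
                                    PrivateNeighbour G Y u v₁ → PrivateNeighbour G Y u v₂ → v₁ ≢ v₂ →
                                    ∣ Γ G ⁅ u ⁆ ∣ ≤ 2
  two-private-neighbours⇒degree≤2 {Y} {u} {v₁} {v₂} surplus u∈Y tight private₁ private₂ v₁≢v₂
    with nonempty? (Y - u)
  ... | no  empty    = ≤-trans (subst (Tight G) (Empty[p-x]⇒p≡⁅x⁆ u∈Y empty) tight)
                               (≤-reflexive (cong suc (∣⁅x⁆∣≡1 u)))
  ... | yes nonempty = ⊥-elim (<⇒≱ (surplus (Y - u) nonempty) (s≤s⁻¹ (s≤s⁻¹ (begin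
      2 + ∣ Γ G (Y - u) ∣     ≤⟨ s≤s (s≤s (p⊆q⇒∣p∣≤∣q∣ Γ[Y-u]⊆ΓY-v₁-v₂)) ⟩
      2 + ∣ Γ G Y - v₁ - v₂ ∣ ≤⟨ s≤s (x∈p⇒∣p-x∣<∣p∣ v₂∈ΓY-v₁) ⟩
      1 + ∣ Γ G Y - v₁ ∣      ≤⟨ x∈p⇒∣p-x∣<∣p∣ v₁∈ΓY ⟩
      ∣ Γ G Y ∣               ≤⟨ tight ⟩
      1 + ∣ Y ∣               ≤⟨ s≤s (∣p∣≤1+∣p-x∣ Y u) ⟩
      2 + ∣ Y - u ∣           ∎))))
    where
    open ≤-Reasoning
    Γ[Y-u]⊆ΓY-v₁-v₂ : Γ G (Y - u) ⊆ Γ G Y - v₁ - v₂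
    Γ[Y-u]⊆ΓY-v₁-v₂ w∈Γ[Y-u] = x∈p∧x≢y⇒x∈p-y (Γ-remove-private G private₁ w∈Γ[Y-u])
                                  (x∈p-y⇒x≢y (Γ-remove-private G private₂ w∈Γ[Y-u]))
    v₁∈ΓY : v₁ ∈ Γ G Y
    v₁∈ΓY = ∈Γ⁺ G u∈Y (proj₁ private₁)
    v₂∈ΓY-v₁ : v₂ ∈ Γ G Y - v₁
    v₂∈ΓY-v₁ = x∈p∧x≢y⇒x∈p-y (∈Γ⁺ G u∈Y (proj₁ private₂)) (v₁≢v₂ ∘ sym)

  critical⇒degree≤2 : PositiveSurplus G → (∀ u v → (u , v) ∈E G → ¬ PositiveSurplus (removeEdge G u v)) →
                      ∀ u → ∣ Γ G ⁅ u ⁆ ∣ ≤ 2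
  critical⇒degree≤2 surplus critical u
    with v₁ , v₁∈Γu ← 0<∣p∣⇒Nonempty (<-≤-trans z<s (positiveSurplus⇒2≤degree G surplus u))
    with v₂ , v₂∈Γu , v₂≢v₁ ← 2≤∣p∣⇒∃≢ (positiveSurplus⇒2≤degree G surplus u) v₁
    with X₁ , u∈X₁ , private₁ , tight₁ ← critical-edge⇒tight-set surplus (critical u v₁ (∈Γ⁅⁆⁻ G v₁∈Γu))
    with X₂ , u∈X₂ , private₂ , tight₂ ← critical-edge⇒tight-set surplus (critical u v₂ (∈Γ⁅⁆⁻ G v₂∈Γu))
    = two-private-neighbours⇒degree≤2 surplus (x∈p∩q⁺ (u∈X₁ , u∈X₂))
        (tight-∩ G surplus (u , u∈X₁) tight₁ tight₂)
        (PrivateNeighbour-restrict (p∩q⊆p X₁ X₂) private₁) (PrivateNeighbour-restrict (p∩q⊆q X₁ X₂) private₂)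
        (v₂≢v₁ ∘ sym)

module _ {m n : ℕ} (G : BipGraph m n) where

  positiveSurplus∧degree≤2⇒forest : PositiveSurplus G → (∀ u → ∣ Γ G ⁅ u ⁆ ∣ ≤ 2) → IsForest G
  positiveSurplus∧degree≤2⇒forest surplus degree≤2 (l , c , c-injective , adj , close) =
    <⇒≱ (surplus left left-nonempty) (≤-trans (p⊆q⇒∣p∣≤∣q∣ Γ[left]⊆right) ∣right∣≤∣left∣)
    where
    onCycle? : ∀ a → Dec (∃ λ i → c i ≡ a)
    onCycle? a = any? (λ i → ≡-dec _≟_ _≟_ (c i) a)

    left : Subset m
    left = subset (onCycle? ∘ inj₁)

    right : Subset n
    right = subset (onCycle? ∘ inj₂)

    Adj-prev : ∀ i → Adj G (c (prev i)) (c i)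
    Adj-prev zero    = close
    Adj-prev (suc j) = adj j

    Adj-next : ∀ i → Adj G (c i) (c (next i))
    Adj-next i = subst (λ j → Adj G (c j) (c (next i))) (prev-next i) (Adj-prev (next i))

    neighbour-of-left : ∀ {i j u} → c i ≡ inj₁ u → Adj G (c i) (c j) → ∃ λ v → c j ≡ inj₂ v × (u , v) ∈E G
    neighbour-of-left cᵢ≡u = Adj-inj₁ G ∘ Adj-respˡ G cᵢ≡u

    Γ[left]⊆right : Γ G left ⊆ right
    Γ[left]⊆right w∈Γleft
      with u , u∈left , uw∈E ← ∈Γ⁻ G w∈Γleft
      with i , cᵢ≡u ← ∈subset⁻ (onCycle? ∘ inj₁) u∈left
      with a , cₚ≡a , ua∈E ← neighbour-of-left cᵢ≡u (Adj-sym G (Adj-prev i))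
      with b , cₙ≡b , ub∈E ← neighbour-of-left cᵢ≡u (Adj-next i)
      with ∣p∣≤2⇒x≡a⊎x≡b (degree≤2 u) (∈Γ⁺ G (x∈⁅x⁆ u) ua∈E) (∈Γ⁺ G (x∈⁅x⁆ u) ub∈E)
             (λ { refl → prev≢next i (c-injective (trans cₚ≡a (sym cₙ≡b))) }) (∈Γ⁺ G (x∈⁅x⁆ u) uw∈E)
    ... | inj₁ refl = ∈subset⁺ (onCycle? ∘ inj₂) (prev i , cₚ≡a)
    ... | inj₂ refl = ∈subset⁺ (onCycle? ∘ inj₂) (next i , cₙ≡b)

    Follows : Fin n → Fin m → Set
    Follows v u = ∃ λ i → c i ≡ inj₂ v × c (next i) ≡ inj₁ u

    ∣right∣≤∣left∣ : ∣ right ∣ ≤ ∣ left ∣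
    ∣right∣≤∣left∣ = injection⇒∣p∣≤∣q∣ right Follows image injective
      where
      image : ∀ {v} → v ∈ right → ∃ λ u → u ∈ left × Follows v u
      image v∈right with i , cᵢ≡v ← ∈subset⁻ (onCycle? ∘ inj₂) v∈right
        with u , cₙ≡u , _ ← Adj-inj₂ G (Adj-respˡ G cᵢ≡v (Adj-next i))
        = u , ∈subset⁺ (onCycle? ∘ inj₁) (next i , cₙ≡u) , i , cᵢ≡v , cₙ≡u
      injective : ∀ {v v′ u} → Follows v u → Follows v′ u → v ≡ v′
      injective (i , cᵢ≡v , cₙ≡u) (i′ , cᵢ′≡v′ , cₙ′≡u)
        with refl ← next-injective {i = i} {i′} (c-injective (trans cₙ≡u (sym cₙ′≡u))) =
        inj₂-injective (trans (sym cᵢ≡v) cᵢ′≡v′)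

    left-nonempty : Nonempty left
    left-nonempty = left-at-or-after zero refl
      where
      left-at-or-after : ∀ i {a} → c i ≡ a → Nonempty left
      left-at-or-after i {inj₁ u} cᵢ≡u = u , ∈subset⁺ (onCycle? ∘ inj₁) (i , cᵢ≡u)
      left-at-or-after i {inj₂ v} cᵢ≡v with u , cₙ≡u , _ ← Adj-inj₂ G (Adj-respˡ G cᵢ≡v (Adj-next i)) =
        u , ∈subset⁺ (onCycle? ∘ inj₁) (next i , cₙ≡u)

-- Forests with all degrees two are minimally DM-irreducible

module _ {m n : ℕ} (G : BipGraph m n) where

  removeEdge-¬positiveSurplus : ∀ {u v} → ∣ Γ G ⁅ u ⁆ ∣ ≤ 2 → (u , v) ∈E G →
                                ¬ PositiveSurplus (removeEdge G u v)
  removeEdge-¬positiveSurplus {u} {v} degree≤2 uv∈E surplus₀ =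
    <⇒≱ (surplus₀ ⁅ u ⁆ (u , x∈⁅x⁆ u)) (s≤s⁻¹ (begin
      suc ∣ Γ (removeEdge G u v) ⁅ u ⁆ ∣ ≤⟨ s≤s (p⊆q⇒∣p∣≤∣q∣ (Γ⁅u₀⁆-removeEdge G u v)) ⟩
      suc ∣ Γ G ⁅ u ⁆ - v ∣              ≤⟨ x∈p⇒∣p-x∣<∣p∣ (∈Γ⁺ G (x∈⁅x⁆ u) uv∈E) ⟩
      ∣ Γ G ⁅ u ⁆ ∣                      ≤⟨ degree≤2 ⟩
      2                                  ≡⟨ cong suc (∣⁅x⁆∣≡1 u) ⟨
      suc ∣ ⁅ u ⁆ ∣                      ∎))
    where open ≤-Reasoning

  closed-walk⇒cycle : (w : ℕ → Vertex m n) → (∀ k → Adj G (w k) (w (suc k))) →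
                      ∀ i l → w (i + (3 + l)) ≡ w i →
                      (∀ {a b} → a < b → b < 3 + l → w (i + a) ≢ w (i + b)) → Cycle G
  closed-walk⇒cycle w walk i l closed distinct = l , segment , segment-injective , step , closing
    where
    segment : Fin (3 + l) → Vertex m n
    segment t = w (i + toℕ t)
    segment-injective : ∀ {s t} → segment s ≡ segment t → s ≡ t
    segment-injective {s} {t} eq with <-cmp (toℕ s) (toℕ t)
    ... | tri< s<t _ _ = ⊥-elim (distinct s<t (toℕ<n t) eq)
    ... | tri≈ _ s≡t _ = toℕ-injective s≡t
    ... | tri> _ _ t<s = ⊥-elim (distinct t<s (toℕ<n s) (sym eq))
    step : ∀ (t : Fin (2 + l)) → Adj G (segment (inject₁ t)) (segment (suc t))
    step t = subst₂ (Adj G) (cong (w ∘ (i +_)) (sym (toℕ-inject₁ t))) (cong w (sym (+-suc i (toℕ t))))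
                    (walk (i + toℕ t))
    closing : Adj G (segment (fromℕ (2 + l))) (segment zero)
    closing = subst₂ (Adj G) (cong (w ∘ (i +_)) (sym (toℕ-fromℕ (2 + l))))
                (trans (cong w (sym (+-suc i (2 + l)))) (trans closed (cong w (sym (+-identityʳ i)))))
                (walk (i + (2 + l)))

  nonBacktracking⇒cycle : (w : ℕ → Vertex m n) → (∀ k → Adj G (w k) (w (suc k))) →
                          (∀ k → w (2 + k) ≢ w k) → Cycle G
  -- Cut the walk at its first repetition w i = w j: j = i + 1 and j = i + 2 are excluded by
  -- irreflexivity and non-backtracking, and otherwise w i, …, w (j - 1) is a cycle.
  nonBacktracking⇒cycle w walk nonBacktracking
    with j , (i , i<j , wᵢ≡wⱼ) , earliest ← least (λ j → anyUpTo? (λ i → ≡-dec _≟_ _≟_ (w i) (w j)) j)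
                                                   _ (proj₂ (walk-repeats w))
    with m≤n⇒∃[o]m+o≡n i<j
  ... | zero , refl =
    ⊥-elim (Adj-irrefl G (subst (Adj G (w i)) (trans (cong w (cong suc (sym (+-identityʳ i)))) (sym wᵢ≡wⱼ)) (walk i)))
  ... | suc zero , refl = ⊥-elim (nonBacktracking i (trans (cong w (cong suc (+-comm 1 i))) (sym wᵢ≡wⱼ)))
  ... | suc (suc l) , refl = closed-walk⇒cycle w walk i l (trans (cong w (+-suc i (2 + l))) (sym wᵢ≡wⱼ))
        λ {a} {b} a<b b<3+l eq → earliest (subst (i + b <_) (+-suc i (2 + l)) (+-monoʳ-< i b<3+l))
                                          (i + a , +-monoʳ-< i a<b , eq)

  Branching : Subset m → Set
  Branching X = ∀ {u v} → u ∈ X → (u , v) ∈E G → ∃ λ u′ → u′ ∈ X × u′ ≢ u × (u′ , v) ∈E G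

  module _ (2≤degree : ∀ u → 2 ≤ ∣ Γ G ⁅ u ⁆ ∣) {X : Subset m} (branching : Branching X) where

    record Dart : Set where
      constructor dart
      field
        tail   : Fin m
        head   : Fin n
        tail∈X : tail ∈ X
        edge∈E : (tail , head) ∈E G

    open Dart

    record Turn (d d′ : Dart) : Set where
      field
        new-tail   : tail d′ ≢ tail d
        tail′-head : (tail d′ , head d) ∈E G
        new-head   : head d′ ≢ head d

    open Turn

    turn : ∀ d → Σ Dart (Turn d)
    turn (dart u v u∈X uv∈E)
      with u′ , u′∈X , u′≢u , u′v∈E ← branching u∈X uv∈E
      with v′ , v′∈Γu′ , v′≢v ← 2≤∣p∣⇒∃≢ (2≤degree u′) v
      = dart u′ v′ u′∈X (∈Γ⁅⁆⁻ G v′∈Γu′) , record { new-tail = u′≢u ; tail′-head = u′v∈E ; new-head = v′≢v }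

    successor : Dart → Dart
    successor = proj₁ ∘ turn

    trail : Dart → ℕ → Vertex m n
    trail d zero          = inj₁ (tail d)
    trail d (suc zero)    = inj₂ (head d)
    trail d (suc (suc k)) = trail (successor d) k

    trail-adjacent : ∀ d k → Adj G (trail d k) (trail d (suc k))
    trail-adjacent d zero          = edge∈E d
    trail-adjacent d (suc zero)    = tail′-head (proj₂ (turn d))
    trail-adjacent d (suc (suc k)) = trail-adjacent (successor d) k

    trail-nonBacktracking : ∀ d k → trail d (2 + k) ≢ trail d k
    trail-nonBacktracking d zero          = new-tail (proj₂ (turn d)) ∘ inj₁-injective
    trail-nonBacktracking d (suc zero)    = new-head (proj₂ (turn d)) ∘ inj₂-injective
    trail-nonBacktracking d (suc (suc k)) = trail-nonBacktracking (successor d) k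

    branching⇒cycle : Nonempty X → Cycle G
    branching⇒cycle (u , u∈X) with v , v∈Γu ← 0<∣p∣⇒Nonempty (<-≤-trans z<s (2≤degree u)) =
      nonBacktracking⇒cycle (trail d) (trail-adjacent d) (trail-nonBacktracking d)
      where
      d : Dart
      d = dart u v u∈X (∈Γ⁅⁆⁻ G v∈Γu)

  shared? : ∀ X u v → Dec (∃ λ x → x ∈ X × x ≢ u × (x , v) ∈E G)
  shared? X u v = any? λ x → x ∈? X ×-dec ¬? (x ≟ u) ×-dec edge G x v Bool.≟ true

  private-or-branching : ∀ X → (∃₂ λ u v → u ∈ X × PrivateNeighbour G X u v) ⊎ Branching X
  private-or-branching X
    with any? (λ u → any? λ v → u ∈? X ×-dec edge G u v Bool.≟ true ×-dec ¬? (shared? X u v))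
  ... | yes (u , v , u∈X , uv∈E , ¬shared) =
    inj₁ (u , v , u∈X , uv∈E , λ x x∈X xv∈E → decidable-stable (x ≟ u) λ x≢u → ¬shared (x , x∈X , x≢u , xv∈E))
  ... | no  none =
    inj₂ λ {u} {v} u∈X uv∈E → decidable-stable (shared? X u v) λ ¬shared → none (u , v , u∈X , uv∈E , ¬shared)

  remove-private : ∀ {X u v} → 2 ≤ ∣ Γ G ⁅ u ⁆ ∣ → u ∈ X → PrivateNeighbour G X u v → ∣ Γ G X ∣ ≤ ∣ X ∣ →
                   Nonempty (X - u) × ∣ Γ G (X - u) ∣ ≤ ∣ X - u ∣
  remove-private {X} {u} {v} 2≤degree u∈X v-private ∣ΓX∣≤∣X∣ = nonempty , s≤s⁻¹ (begin
    suc ∣ Γ G (X - u) ∣ ≤⟨ s≤s (p⊆q⇒∣p∣≤∣q∣ (Γ-remove-private G v-private)) ⟩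
    suc ∣ Γ G X - v ∣   ≤⟨ x∈p⇒∣p-x∣<∣p∣ (∈Γ⁺ G u∈X (proj₁ v-private)) ⟩
    ∣ Γ G X ∣           ≤⟨ ∣ΓX∣≤∣X∣ ⟩
    ∣ X ∣               ≤⟨ ∣p∣≤1+∣p-x∣ X u ⟩
    suc ∣ X - u ∣       ∎)
    where
    open ≤-Reasoning
    nonempty : Nonempty (X - u)
    nonempty = decidable-stable (nonempty? (X - u)) λ empty →
      <⇒≱ 2≤degree (≤-trans (subst (λ Y → ∣ Γ G Y ∣ ≤ ∣ Y ∣) (Empty[p-x]⇒p≡⁅x⁆ u∈X empty) ∣ΓX∣≤∣X∣)
                             (≤-reflexive (∣⁅x⁆∣≡1 u)))

  2≤degree∧forest⇒positiveSurplus : (∀ u → 2 ≤ ∣ Γ G ⁅ u ⁆ ∣) → IsForest G → PositiveSurplus G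
  2≤degree∧forest⇒positiveSurplus 2≤degree forest X nonempty = ≰⇒> (not-deficient ∣ X ∣ ≤-refl nonempty)
    where
    not-deficient : ∀ k {X} → ∣ X ∣ ≤ k → Nonempty X → ¬ ∣ Γ G X ∣ ≤ ∣ X ∣
    not-deficient zero    ∣X∣≤0 (u , u∈X) _ = <⇒≱ (≤-<-trans z≤n (x∈p⇒∣p-x∣<∣p∣ u∈X)) ∣X∣≤0
    not-deficient (suc k) {X} ∣X∣≤1+k nonempty ∣ΓX∣≤∣X∣ with private-or-branching X
    ... | inj₂ branching = forest (branching⇒cycle 2≤degree branching nonempty)
    ... | inj₁ (u , v , u∈X , v-private)
      with nonempty′ , ∣Γ[X-u]∣≤∣X-u∣ ← remove-private (2≤degree u) u∈X v-private ∣ΓX∣≤∣X∣ =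
      not-deficient k (s≤s⁻¹ (≤-trans (x∈p⇒∣p-x∣<∣p∣ u∈X) ∣X∣≤1+k)) nonempty′ ∣Γ[X-u]∣≤∣X-u∣

lemma4p2 : ∀ {m n : ℕ} (G : BipGraph m n) → m < n →
    MinimallyDMIrreducible G ⇔ ((∀ u → ∣ Γ G ⁅ u ⁆ ∣ ≡ 2) × IsForest G)
lemma4p2 {m} {n} G m<n = mk⇔ necessary sufficient
  where
  dm⇔surplus : (H : BipGraph m n) → DMIrreducible H ⇔ PositiveSurplus H
  dm⇔surplus H = dmIrreducible⇔positiveSurplus H m<n

  necessary : MinimallyDMIrreducible G → (∀ u → ∣ Γ G ⁅ u ⁆ ∣ ≡ 2) × IsForest G
  necessary (irreducible , minimal) =
    (λ u → ≤-antisym (degree≤2 u) (positiveSurplus⇒2≤degree G surplus u)) ,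
    positiveSurplus∧degree≤2⇒forest G surplus degree≤2
    where
    surplus : PositiveSurplus G
    surplus = to (dm⇔surplus G) irreducible
    degree≤2 : ∀ u → ∣ Γ G ⁅ u ⁆ ∣ ≤ 2
    degree≤2 = critical⇒degree≤2 G surplus λ u v uv∈E →
      minimal u v uv∈E ∘ from (dm⇔surplus (removeEdge G u v))

  sufficient : (∀ u → ∣ Γ G ⁅ u ⁆ ∣ ≡ 2) × IsForest G → MinimallyDMIrreducible G
  sufficient (degree≡2 , forest) =
    from (dm⇔surplus G) (2≤degree∧forest⇒positiveSurplus G (≤-reflexive ∘ sym ∘ degree≡2) forest) ,
    λ u v uv∈E →
      removeEdge-¬positiveSurplus G (≤-reflexive (degree≡2 u)) uv∈E ∘ to (dm⇔surplus (removeEdge G u v))
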